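{- For every $q\ge2$ and every integer $t\ge3$, \[ N^*(t-2)+2\le N_q(t)\le N_2(t)\le N^*(t). \]
   Context: A family $\mathcal F\subseteq2^{[n]}$ is $t$-cover-free if $A_0\not\subseteq A_1\cup\dots\cup A_r$ for all distinct $A_0,\dots,A_r\in\mathcal F$ with $r\le t$. $N^*(t)$ is the minimum $n$ such that there exists a $t$-cover-free family $\mathcal F\subseteq2^{[n]}$ with $|\mathcal F|>n$. Let $Q=\{0,\dots,q-1\}$; for a nonempty $X=\{\mathbf c^1,\dots,\mathbf c^s\}\subseteq Q^n$ let $U(X)=\{i: c^1_i=\dots=c^s_i\}$ and $\mathrm{wdesc}(X)=\{\mathbf y\in Q^n: y_i=c^1_i\ \forall i\in U(X)\}$; a code $\mathcal C\subseteq Q^n$ is a wide-sense $t$-frameproof code if $\mathrm{wdesc}(X)\cap\mathcal C=X$ for every nonempty $X\subseteq\mathcal C$ with $|X|\le t$. $N_q(t)$ is the minimum $n\ge2$ such that there exists a wide-sense $t$-frameproof code $\mathcal C\subseteq Q^n$ with $|\mathcal C|>n$. -}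

module Defs where

open import Data.Nat using (ℕ; _≤_; _<_)
open import Data.Fin using (Fin)
open import Data.Fin.Subset using (Subset; _∈_; _∉_; ∣_∣)
open import Data.Vec using (Vec; lookup)
open import Data.Product using (Σ; _×_)
open import Data.Empty using (⊥)
open import Relation.Nullary using (¬_)
open import Relation.Binary.PropositionalEquality using (_≡_)
open import Function.Bundles using (_⇔_)

IsMinimum : (ℕ → Set) → ℕ → Set
IsMinimum P n = P n × (∀ m → P m → n ≤ m)

InjectiveMap : ∀ {A : Set} {m : ℕ} → (Fin m → A) → Set
InjectiveMap {m = m} F = ∀ (i j : Fin m) → F i ≡ F j → i ≡ j

-- Cover-free families: a family F ⊆ 2^[n] of size m is given as an
-- injective map F : Fin m → Subset n.

CoveredBy : ∀ {m n} → (Fin m → Subset n) → Fin m → Subset m → Set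
CoveredBy F i₀ S = ∀ (x : Fin _) → x ∈ F i₀ → Σ (Fin _) λ j → (j ∈ S) × (x ∈ F j)

CoverFree : ∀ {m n} → ℕ → (Fin m → Subset n) → Set
CoverFree {m} t F = ∀ (i₀ : Fin m) (S : Subset m) → i₀ ∉ S → ∣ S ∣ ≤ t → ¬ CoveredBy F i₀ S

CFExists : ℕ → ℕ → Set
CFExists t n = Σ ℕ λ m → (n < m) × Σ (Fin m → Subset n) λ F → InjectiveMap F × CoverFree t F

-- Codes: a code C ⊆ Q^n with |C| = m, Q = Fin q, given as an injective
-- map C : Fin m → Vec (Fin q) n.  A subset X ⊆ C is given by X : Subset m.

InU : ∀ {m n q} → (Fin m → Vec (Fin q) n) → Subset m → Fin n → Set
InU C X i = ∀ j j' → j ∈ X → j' ∈ X → lookup (C j) i ≡ lookup (C j') i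

InWdesc : ∀ {m n q} → (Fin m → Vec (Fin q) n) → Subset m → Vec (Fin q) n → Set
InWdesc C X y = ∀ i → InU C X i → ∀ j → j ∈ X → lookup y i ≡ lookup (C j) i

WideFrameproof : ∀ {m n q} → ℕ → (Fin m → Vec (Fin q) n) → Set
WideFrameproof {m} t C =
  ∀ (X : Subset m) → 1 ≤ ∣ X ∣ → ∣ X ∣ ≤ t → ∀ (k : Fin m) → (InWdesc C X (C k) ⇔ (k ∈ X))

FPExists : ℕ → ℕ → ℕ → Set
FPExists q t n = (2 ≤ n) × Σ ℕ λ m → (n < m) ×
  Σ (Fin m → Vec (Fin q) n) λ C → InjectiveMap C × WideFrameproof t C

{-# OPTIONS --safe #-}
-- Upper bounds: a code over {0,1} becomes a code over Q by an injective relabelling of the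
-- alphabet, which preserves which coordinates agree and hence wide-sense frameproofness; and
-- the indicator vectors of a t-cover-free family form a binary wide-sense t-frameproof code,
-- since a codeword outside X that lies in wdesc(X) reads 0 off the union of X, so its
-- support is covered by X.
--
-- Lower bound: fix two codewords c₀, c₁ of a wide-sense t-frameproof code and give every
-- other codeword c the set of positions where c₀ and c₁ agree but c does not.  If the set of
-- c were covered by those of t − 2 others, then c would lie in wdesc of these together with
-- c₀ and c₁; so the family is (t − 2)-cover-free.  Positions where c₀ and c₁ disagree belong
-- to no set, and separating c₁ from {c₀, c₂} and c₀ from {c₁, c₂} yields two of them.
-- Deleting these two points leaves m − 2 > n − 2 sets on n − 2 points.
module Submission where

open import Defs
open import Data.Bool using (Bool; true; false)
open import Data.Empty using (⊥-elim)
open import Data.Fin using (Fin; zero; suc; punchOut; inject≤)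
open import Data.Fin.Properties using (_≟_; any?; all?; ¬∀⟶∃¬; inject≤-injective)
open import Data.Fin.Subset using (Subset; _∈_; _∉_; ∣_∣; ⁅_⁆; ⊥; inside; outside; Nonempty)
open import Data.Fin.Subset.Properties using (_∈?_; nonempty?; ∉⊥; x∈⁅x⁆; x∈⁅y⁆⇒x≡y; ∣⁅x⁆∣≡1; ∣⊥∣≡0)
open import Data.Nat using (ℕ; zero; suc; _≤_; _+_; _∸_; z≤n; s≤s)
open import Data.Nat.Properties using (≤-trans; ≤-reflexive; +-monoˡ-≤; m∸n+n≡m; module ≤-Reasoning)
open import Data.Product using (Σ; ∃; ∃₂; _×_; _,_; proj₁; proj₂)
open import Data.Vec using (Vec; []; _∷_; lookup; map; tabulate; removeAt; here; there)
open import Data.Vec.Properties using (lookup-map; lookup∘tabulate; removeAt-punchOut; []=⇒lookup; lookup⇒[]=; ∷-injective)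
open import Function using (_∘_; const)
open import Function.Bundles using (_⇔_; mk⇔; Equivalence)
open import Function.Construct.Symmetry using (⇔-sym)
open import Function.Definitions using (Injective)
open import Relation.Nullary using (¬_; Dec; yes; no; does)
open import Relation.Nullary.Decidable using (_×-dec_; _→-dec_; ¬?; dec-true; decidable-stable)
open import Relation.Binary.PropositionalEquality using (_≡_; _≢_; refl; sym; trans; cong; cong₂; subst; module ≡-Reasoning)

open Equivalence using (to; from)

map-injective : ∀ {A B : Set} {f : A → B} → Injective _≡_ _≡_ f →
                ∀ {n} → Injective _≡_ _≡_ (map {n = n} f)
map-injective f-inj {x = []}    {[]}    _  = refl
map-injective f-inj {x = a ∷ u} {b ∷ v} eq =
  cong₂ _∷_ (f-inj (proj₁ (∷-injective eq))) (map-injective f-inj (proj₂ (∷-injective eq)))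

1≤∣p∣⇒Nonempty : ∀ {n} (p : Subset n) → 1 ≤ ∣ p ∣ → Nonempty p
1≤∣p∣⇒Nonempty (inside  ∷ p) _     = zero , here
1≤∣p∣⇒Nonempty (outside ∷ p) 1≤∣p∣ =
  let (x , x∈p) = 1≤∣p∣⇒Nonempty p 1≤∣p∣ in suc x , there x∈p

subsetOf : ∀ {n} {P : Fin n → Set} → (∀ x → Dec (P x)) → Subset n
subsetOf P? = tabulate (does ∘ P?)

∈-subsetOf : ∀ {n} {P : Fin n → Set} (P? : ∀ x → Dec (P x)) {x} → x ∈ subsetOf P? ⇔ P x
∈-subsetOf P? {x} = mk⇔
  (does≡true⇒ (P? x) ∘ trans (sym (lookup∘tabulate _ x)) ∘ []=⇒lookup)
  (lookup⇒[]= x _ ∘ trans (lookup∘tabulate _ x) ∘ dec-true (P? x))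
  where
  does≡true⇒ : ∀ {A : Set} (a? : Dec A) → does a? ≡ true → A
  does≡true⇒ (yes a) _ = a
  does≡true⇒ (no _) ()

∈-removeAt : ∀ {n} (S : Subset (suc n)) {p x} (p≢x : p ≢ x) → punchOut p≢x ∈ removeAt S p ⇔ x ∈ S
∈-removeAt S p≢x = mk⇔
  (lookup⇒[]= _ S ∘ trans (sym (removeAt-punchOut S p≢x)) ∘ []=⇒lookup)
  (lookup⇒[]= _ _ ∘ trans (removeAt-punchOut S p≢x) ∘ []=⇒lookup)

-- Cover-free families

CoverFree⇒Nonempty : ∀ {m n t} {F : Fin m → Subset n} → CoverFree t F → ∀ i → Nonempty (F i)
CoverFree⇒Nonempty {m} {F = F} cf i = decidable-stable (nonempty? (F i)) λ Fi-empty →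
  cf i ⊥ ∉⊥ (subst (_≤ _) (sym (∣⊥∣≡0 m)) z≤n) λ x x∈Fi → ⊥-elim (Fi-empty (x , x∈Fi))

CoverFree⇒Injective : ∀ {m n t} {F : Fin m → Subset n} → 1 ≤ t → CoverFree t F → InjectiveMap F
CoverFree⇒Injective 1≤t cf i j Fi≡Fj = decidable-stable (i ≟ j) λ i≢j →
  cf i ⁅ j ⁆ (i≢j ∘ x∈⁅y⁆⇒x≡y j) (≤-trans (≤-reflexive (∣⁅x⁆∣≡1 j)) 1≤t)
     λ x x∈Fi → j , x∈⁅x⁆ j , subst (x ∈_) Fi≡Fj x∈Fi

Nonempty-Subset1 : {S : Subset 1} → Nonempty S → S ≡ inside ∷ []
Nonempty-Subset1 {inside  ∷ []} _          = refl
Nonempty-Subset1 {outside ∷ []} (zero , ())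

CFExists⇒2≤n : ∀ {t n} → CFExists t n → 2 ≤ n
CFExists⇒2≤n {n = 0} (suc m , _ , _ , _ , cf) with CoverFree⇒Nonempty cf zero
... | () , _
CFExists⇒2≤n {n = 1} (suc (suc m) , _ , _ , F-inj , cf)
  with F-inj zero (suc zero) (trans (Nonempty-Subset1 (CoverFree⇒Nonempty cf zero))
                                    (sym (Nonempty-Subset1 (CoverFree⇒Nonempty cf (suc zero)))))
... | ()
CFExists⇒2≤n {n = 1} (1 , s≤s () , _)
CFExists⇒2≤n {n = suc (suc n)} _ = s≤s (s≤s z≤n)

Unused : ∀ {m n} → (Fin m → Subset n) → Fin n → Set
Unused F x = ∀ c → x ∉ F c

CoverFree-removeAt : ∀ {m n t} {F : Fin m → Subset (suc n)} {p} → Unused F p →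
                     CoverFree t F → CoverFree t (λ c → removeAt (F c) p)
CoverFree-removeAt {F = F} {p} p-unused cf i₀ S i₀∉S ∣S∣≤t covered = cf i₀ S i₀∉S ∣S∣≤t covered′
  where
  covered′ : CoveredBy F i₀ S
  covered′ x x∈Fi₀ =
    let p≢x : p ≢ x
        p≢x = λ { refl → p-unused i₀ x∈Fi₀ }
        (j , j∈S , x∈Fj) = covered (punchOut p≢x) (from (∈-removeAt (F i₀) p≢x) x∈Fi₀)
    in j , j∈S , to (∈-removeAt (F j) p≢x) x∈Fj

Unused-removeAt : ∀ {m n} {F : Fin m → Subset (suc n)} {p p′} (p≢p′ : p ≢ p′) →
                  Unused F p′ → Unused (λ c → removeAt (F c) p) (punchOut p≢p′)
Unused-removeAt {F = F} p≢p′ p′-unused c = p′-unused c ∘ to (∈-removeAt (F c) p≢p′)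

CoverFree-removeUnused₂ : ∀ {m n t} {F : Fin m → Subset (suc (suc n))} {i j} → i ≢ j →
                          Unused F i → Unused F j → CoverFree t F →
                          Σ (Fin m → Subset n) (CoverFree t)
CoverFree-removeUnused₂ {F = F} {i} i≢j i-unused j-unused cf =
  (λ c → removeAt (removeAt (F c) i) (punchOut i≢j)) ,
  CoverFree-removeAt (Unused-removeAt i≢j j-unused) (CoverFree-removeAt i-unused cf)

-- Relabelling the alphabet

record SameAgreement {m n q r} (C : Fin m → Vec (Fin q) n) (D : Fin m → Vec (Fin r) n) : Set where
  constructor sameAgreement
  field agree : ∀ x j j′ → lookup (C j) x ≡ lookup (C j′) x ⇔ lookup (D j) x ≡ lookup (D j′) x

open SameAgreement

SameAgreement-sym : ∀ {m n q r} {C : Fin m → Vec (Fin q) n} {D : Fin m → Vec (Fin r) n} →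
                    SameAgreement C D → SameAgreement D C
SameAgreement-sym same = sameAgreement λ x j j′ → ⇔-sym (agree same x j j′)

InU-transfer : ∀ {m n q r} {C : Fin m → Vec (Fin q) n} {D : Fin m → Vec (Fin r) n} →
               SameAgreement C D → ∀ {X x} → InU C X x → InU D X x
InU-transfer same u j j′ j∈X j′∈X = to (agree same _ j j′) (u j j′ j∈X j′∈X)

InWdesc-transfer : ∀ {m n q r} {C : Fin m → Vec (Fin q) n} {D : Fin m → Vec (Fin r) n} →
                   SameAgreement C D → ∀ {X} k → InWdesc C X (C k) → InWdesc D X (D k)
InWdesc-transfer same k w x u j j∈X =
  to (agree same x k j) (w x (InU-transfer (SameAgreement-sym same) u) j j∈X)

WideFrameproof-transfer : ∀ {m n q r t} {C : Fin m → Vec (Fin q) n} {D : Fin m → Vec (Fin r) n} →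
                          SameAgreement C D → WideFrameproof t C → WideFrameproof t D
WideFrameproof-transfer same fp X 1≤∣X∣ ∣X∣≤t k = mk⇔
  (to (fp X 1≤∣X∣ ∣X∣≤t k) ∘ InWdesc-transfer (SameAgreement-sym same) k)
  (InWdesc-transfer same k ∘ from (fp X 1≤∣X∣ ∣X∣≤t k))

SameAgreement-map : ∀ {m n q r} {e : Fin q → Fin r} → Injective _≡_ _≡_ e →
                    (C : Fin m → Vec (Fin q) n) → SameAgreement C (λ k → map e (C k))
SameAgreement-map {e = e} e-inj C = sameAgreement agreeₑ
  where
  agreeₑ : ∀ x j j′ → lookup (C j) x ≡ lookup (C j′) x ⇔ lookup (map e (C j)) x ≡ lookup (map e (C j′)) x
  agreeₑ x j j′ rewrite lookup-map x e (C j) | lookup-map x e (C j′) = mk⇔ (cong e) e-inj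

FPExists-relabel : ∀ {q r t n} → q ≤ r → FPExists q t n → FPExists r t n
FPExists-relabel q≤r (2≤n , m , n<m , C , C-inj , fp) =
  2≤n , m , n<m , (λ k → map e (C k)) , (λ i j → C-inj i j ∘ map-injective e-inj) ,
  WideFrameproof-transfer (SameAgreement-map e-inj C) fp
  where
  e = λ a → inject≤ a q≤r
  e-inj : Injective _≡_ _≡_ e
  e-inj = inject≤-injective q≤r q≤r _ _

-- The indicator code of a cover-free family

toBit : Bool → Fin 2
toBit false = zero
toBit true  = suc zero

toBit-injective : Injective _≡_ _≡_ toBit
toBit-injective {false} {false} _ = refl
toBit-injective {true}  {true}  _ = refl

indicator : ∀ {n} → Subset n → Vec (Fin 2) n
indicator = map toBit

lookup-indicator-∈ : ∀ {n} {S : Subset n} {x} → x ∈ S → lookup (indicator S) x ≡ suc zero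
lookup-indicator-∈ here        = refl
lookup-indicator-∈ (there x∈S) = lookup-indicator-∈ x∈S

lookup-indicator-∉ : ∀ {n} (S : Subset n) x → x ∉ S → lookup (indicator S) x ≡ zero
lookup-indicator-∉ (inside  ∷ S) zero    x∉S = ⊥-elim (x∉S here)
lookup-indicator-∉ (outside ∷ S) zero    _   = refl
lookup-indicator-∉ (_       ∷ S) (suc x) x∉S = lookup-indicator-∉ S x (x∉S ∘ there)

indicator-InWdesc⇒CoveredBy : ∀ {m n} (F : Fin m → Subset n) {X k} → 1 ≤ ∣ X ∣ →
                              InWdesc (indicator ∘ F) X (indicator (F k)) → CoveredBy F k X
indicator-InWdesc⇒CoveredBy F {X} {k} 1≤∣X∣ w x x∈Fk with any? (λ j → j ∈? X ×-dec x ∈? F j)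
... | yes covered  = covered
... | no uncovered = ⊥-elim (1≢0 (begin
  suc zero                     ≡⟨ sym (lookup-indicator-∈ x∈Fk) ⟩
  lookup (indicator (F k)) x   ≡⟨ w x x∈U j₀ j₀∈X ⟩
  lookup (indicator (F j₀)) x  ≡⟨ reads0 j₀∈X ⟩
  zero                         ∎))
  where
  open ≡-Reasoning
  1≢0 : suc zero ≢ zero {1}
  1≢0 ()
  reads0 : ∀ {j} → j ∈ X → lookup (indicator (F j)) x ≡ zero
  reads0 {j} j∈X = lookup-indicator-∉ (F j) x λ x∈Fj → uncovered (j , j∈X , x∈Fj)
  x∈U : InU (indicator ∘ F) X x
  x∈U j j′ j∈X j′∈X = trans (reads0 j∈X) (sym (reads0 j′∈X))
  j₀ = proj₁ (1≤∣p∣⇒Nonempty X 1≤∣X∣)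
  j₀∈X = proj₂ (1≤∣p∣⇒Nonempty X 1≤∣X∣)

indicator-frameproof : ∀ {m n t} {F : Fin m → Subset n} →
                       CoverFree t F → WideFrameproof t (indicator ∘ F)
indicator-frameproof {F = F} cf X 1≤∣X∣ ∣X∣≤t k = mk⇔
  (λ w → decidable-stable (k ∈? X) λ k∉X →
           cf k X k∉X ∣X∣≤t (indicator-InWdesc⇒CoveredBy F 1≤∣X∣ w))
  (λ k∈X x u j j∈X → u k j k∈X j∈X)

CFExists⇒FPExists₂ : ∀ {t n} → CFExists t n → FPExists 2 t n
CFExists⇒FPExists₂ ex@(m , n<m , F , F-inj , cf) =
  CFExists⇒2≤n ex , m , n<m , indicator ∘ F ,
  (λ i j → F-inj i j ∘ map-injective toBit-injective) , indicator-frameproof cf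

-- From a frameproof code to a cover-free family

InU? : ∀ {m n q} (C : Fin m → Vec (Fin q) n) X x → Dec (InU C X x)
InU? C X x = all? λ j → all? λ j′ → j ∈? X →-dec (j′ ∈? X →-dec lookup (C j) x ≟ lookup (C j′) x)

frameproof-separates : ∀ {m n q t} {C : Fin m → Vec (Fin q) n} → WideFrameproof t C →
                       ∀ {X} → 1 ≤ ∣ X ∣ → ∣ X ∣ ≤ t → ∀ {a k} → a ∈ X → k ∉ X →
                       ∃ λ x → InU C X x × lookup (C k) x ≢ lookup (C a) x
frameproof-separates {n = n} {C = C} fp {X} 1≤∣X∣ ∣X∣≤t {a} {k} a∈X k∉X =
  separating (¬∀⟶∃¬ n _ (λ x → InU? C X x →-dec (lookup (C k) x ≟ lookup (C a) x)) ¬agreesOnU)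
  where
  ¬agreesOnU : ¬ (∀ x → InU C X x → lookup (C k) x ≡ lookup (C a) x)
  ¬agreesOnU agree = k∉X (to (fp X 1≤∣X∣ ∣X∣≤t k) λ x u j j∈X → trans (agree x u) (u a j a∈X j∈X))
  separating : (∃ λ x → ¬ (InU C X x → lookup (C k) x ≡ lookup (C a) x)) →
               ∃ λ x → InU C X x × lookup (C k) x ≢ lookup (C a) x
  separating (x , ¬agree) =
    x , decidable-stable (InU? C X x) (λ ¬u → ¬agree (⊥-elim ∘ ¬u)) , ¬agree ∘ const

Deviates : ∀ {m n q} → (Fin (suc (suc m)) → Vec (Fin q) n) → Fin m → Fin n → Set
Deviates C c x = lookup (C zero) x ≡ lookup (C (suc zero)) x × lookup (C (suc (suc c))) x ≢ lookup (C zero) x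

deviates? : ∀ {m n q} (C : Fin (suc (suc m)) → Vec (Fin q) n) c x → Dec (Deviates C c x)
deviates? C c x =
  (lookup (C zero) x ≟ lookup (C (suc zero)) x) ×-dec ¬? (lookup (C (suc (suc c))) x ≟ lookup (C zero) x)

deviationFamily : ∀ {m n q} → (Fin (suc (suc m)) → Vec (Fin q) n) → Fin m → Subset n
deviationFamily C c = subsetOf (deviates? C c)

∈-deviationFamily : ∀ {m n q} (C : Fin (suc (suc m)) → Vec (Fin q) n) {c x} →
                    x ∈ deviationFamily C c ⇔ Deviates C c x
∈-deviationFamily C {c} = ∈-subsetOf (deviates? C c)

deviationFamily-coverFree : ∀ {m n q s} {C : Fin (suc (suc m)) → Vec (Fin q) n} →
                            WideFrameproof (2 + s) C → CoverFree s (deviationFamily C)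
deviationFamily-coverFree {C = C} fp i₀ S i₀∉S ∣S∣≤s covered =
  i₀∉S (drop₂ (to (fp X (s≤s z≤n) (s≤s (s≤s ∣S∣≤s)) (suc (suc i₀))) i₀-descends))
  where
  X = inside ∷ inside ∷ S
  drop₂ : suc (suc i₀) ∈ X → i₀ ∈ S
  drop₂ (there (there i₀∈S)) = i₀∈S
  i₀-descends : InWdesc C X (C (suc (suc i₀)))
  i₀-descends x u j j∈X with lookup (C (suc (suc i₀))) x ≟ lookup (C zero) x
  ... | yes agrees = trans agrees (u zero j here j∈X)
  ... | no differs =
    let c₀≡c₁ = u zero (suc zero) here (there here)
        (j′ , j′∈S , x∈Fj′) = covered x (from (∈-deviationFamily C) (c₀≡c₁ , differs))
        c′≢c₀ = proj₂ (to (∈-deviationFamily C) x∈Fj′)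
    in ⊥-elim (c′≢c₀ (u (suc (suc j′)) zero (there (there j′∈S)) here))

deviationFamily-Unused : ∀ {m n q} (C : Fin (suc (suc m)) → Vec (Fin q) n) {x} →
                         lookup (C zero) x ≢ lookup (C (suc zero)) x → Unused (deviationFamily C) x
deviationFamily-Unused C c₀≢c₁ c = c₀≢c₁ ∘ proj₁ ∘ to (∈-deviationFamily C)

twoDisagreementPositions : ∀ {m n q t} {C : Fin (suc (suc (suc m))) → Vec (Fin q) n} →
                           2 ≤ t → WideFrameproof t C →
                           ∃₂ λ i j → i ≢ j × lookup (C zero) i ≢ lookup (C (suc zero)) i
                                            × lookup (C zero) j ≢ lookup (C (suc zero)) j
twoDisagreementPositions {m} {t = t} {C = C} 2≤t fp =
  let (i , i∈U , c₁≢c₀) = frameproof-separates {C = C} fp {X₀₂} (s≤s z≤n) ∣X∣≤t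
                                                {zero} {suc zero} here λ { (there ()) }
      (j , j∈U , c₀≢c₁) = frameproof-separates {C = C} fp {X₁₂} (s≤s z≤n) ∣X∣≤t
                                                {suc zero} {zero} (there here) λ ()
  in i , j ,
     distinct (i∈U (suc (suc zero)) zero (there (there here)) here)
              (j∈U (suc (suc zero)) (suc zero) (there (there here)) (there here)) c₀≢c₁ ,
     c₁≢c₀ ∘ sym , c₀≢c₁
  where
  X₀₂ X₁₂ : Subset (suc (suc (suc m)))
  X₀₂ = inside  ∷ outside ∷ inside ∷ ⊥
  X₁₂ = outside ∷ inside  ∷ inside ∷ ⊥
  ∣X∣≤t : 2 + ∣ ⊥ {m} ∣ ≤ t
  ∣X∣≤t = subst (_≤ t) (sym (cong (2 +_) (∣⊥∣≡0 m))) 2≤t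
  distinct : ∀ {i j} → lookup (C (suc (suc zero))) i ≡ lookup (C zero) i →
             lookup (C (suc (suc zero))) j ≡ lookup (C (suc zero)) j →
             lookup (C zero) j ≢ lookup (C (suc zero)) j → i ≢ j
  distinct c₂≡c₀ c₂≡c₁ c₀≢c₁ refl = c₀≢c₁ (trans (sym c₂≡c₀) c₂≡c₁)

frameproof⇒coverFree : ∀ {m n q s} (C : Fin (suc (suc (suc m))) → Vec (Fin q) (suc (suc n))) →
                       WideFrameproof (2 + s) C → Σ (Fin (suc m) → Subset n) (CoverFree s)
frameproof⇒coverFree C fp =
  let (i , j , i≢j , i-differs , j-differs) = twoDisagreementPositions {C = C} (s≤s (s≤s z≤n)) fp
  in CoverFree-removeUnused₂ {F = deviationFamily C} i≢j
       (deviationFamily-Unused C i-differs) (deviationFamily-Unused C j-differs)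
       (deviationFamily-coverFree {C = C} fp)

FPExists⇒CFExists : ∀ {q t n} → 3 ≤ t → FPExists q t n → CFExists (t ∸ 2) (n ∸ 2)
FPExists⇒CFExists {n = 0} _ (() , _)
FPExists⇒CFExists {n = 1} _ (s≤s () , _)
FPExists⇒CFExists {t = suc (suc (suc s))} {n = suc (suc n)} (s≤s (s≤s (s≤s _)))
                  (_ , suc (suc (suc m)) , s≤s (s≤s (s≤s n≤m)) , C , _ , fp) =
  let (F , cf) = frameproof⇒coverFree C fp
  in suc m , s≤s n≤m , F , CoverFree⇒Injective (s≤s z≤n) cf , cf

proposition7p2 : ∀ (q t : ℕ) → 2 ≤ q → 3 ≤ t →
    ∀ (a b c d : ℕ) →
    IsMinimum (CFExists (t ∸ 2)) a →
    IsMinimum (FPExists q t) b →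
    IsMinimum (FPExists 2 t) c →
    IsMinimum (CFExists t) d →
    (a + 2 ≤ b) × (b ≤ c) × (c ≤ d)
proposition7p2 q t 2≤q 3≤t a b c d (_ , a-min) (b-ex , b-min) (c-ex , c-min) (d-ex , _) =
  a+2≤b , b-min c (FPExists-relabel 2≤q c-ex) , c-min d (CFExists⇒FPExists₂ d-ex)
  where
  open ≤-Reasoning
  a+2≤b : a + 2 ≤ b
  a+2≤b = begin
    a + 2      ≤⟨ +-monoˡ-≤ 2 (a-min (b ∸ 2) (FPExists⇒CFExists 3≤t b-ex)) ⟩
    b ∸ 2 + 2  ≡⟨ m∸n+n≡m (proj₁ b-ex) ⟩
    b          ∎
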